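{- None of the following description logics enjoys the Craig interpolation property (CIP), and none of them enjoys the projective Beth definability property (PBDP): (1) $\mathcal{EL}_u$ ($\mathcal{EL}$ with the universal role); (2) $\mathcal{ELO}$ ($\mathcal{EL}$ with nominals); (3) $\mathcal{EL}$ with a single role inclusion $r\circ s\sqsubseteq s$ (ontologies consist of $\mathcal{EL}$-concept inclusions together with this one role inclusion, for role names $r,s$); (4) $\mathcal{EL}$ with role hierarchies and a transitive role (ontologies consist of $\mathcal{EL}$-concept inclusions, role inclusions of the form $r\sqsubseteq s$, and a transitivity axiom $s\circ s\sqsubseteq s$ for a role name $s$); (5) $\mathcal{ELI}$ ($\mathcal{EL}$ with inverse roles). Moreover, for each of the logics in (2)–(5), the CIP and the PBDP still fail if the universal role $u$ is additionally allowed to occur in interpolants and explicit definitions; that is, there are ontologies and concepts of that logic with $\mathcal{O}_1\cup\mathcal{O}_2\models C_1\sqsubseteq C_2$ for which no interpolant exists even among concepts of that logic extended with $u$, and there are an ontology $\mathcal{O}$ of that logic, a signature $\Sigma\subseteq \mathrm{sig}(\mathcal{O})$ and a concept name $A$ implicitly definable using $\Sigma$ under $\mathcal{O}$ that has no explicit definition among concepts of that logic extended with $u$ using only symbols from $\Sigma$.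
   Context: Fix disjoint countably infinite sets $N_C$ (concept names), $N_R$ (role names), $N_I$ (individual names). A role is a role name $r$ or an inverse role $r^-$; $u$ denotes the universal role, interpreted as $\Delta^{\mathcal I}\times\Delta^{\mathcal I}$, and $u$ is not counted as a symbol of any signature. $\mathcal{ELIO}_u$-concepts are given by $C ::= \top \mid A \mid \{a\} \mid C\sqcap C \mid \exists r.C$ with $A\in N_C$, $a\in N_I$ (nominal $\{a\}$), $r$ a role or $u$. $\mathcal{EL}$ disallows nominals, inverse roles and $u$; subscripts/letters add features: $u$ = universal role, $\mathcal O$ = nominals, $\mathcal I$ = inverse roles. An ontology is a finite set of concept inclusions (CIs) $C\sqsubseteq D$ and, where allowed, role inclusions $r_1\circ\dots\circ r_n\sqsubseteq r$ (role names), satisfied in an interpretation $\mathcal I$ if $r_1^{\mathcal I}\circ\cdots\circ r_n^{\mathcal I}\subseteq r^{\mathcal I}$. Semantics is standard; $\mathcal O\models\alpha$ means every model of $\mathcal O$ satisfies $\alpha$, and $\mathcal O\models C\equiv D$ means both inclusions hold. $\mathrm{sig}(X)$ is the set of concept, role and individual names in $X$; $\mathrm{sig}(\mathcal O,C)=\mathrm{sig}(\mathcal O)\cup\mathrm{sig}(C)$. For a DL $\mathcal L$, an $\mathcal L$-interpolant for $C_1\sqsubseteq C_2$ under ontologies $\mathcal O_1,\mathcal O_2$ is an $\mathcal L$-concept $D$ with $\mathrm{sig}(D)\subseteq\mathrm{sig}(\mathcal O_1,C_1)\cap\mathrm{sig}(\mathcal O_2,C_2)$, $\mathcal O_1\cup\mathcal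 O_2\models C_1\sqsubseteq D$ and $\mathcal O_1\cup\mathcal O_2\models D\sqsubseteq C_2$. $\mathcal L$ has the CIP if for all $\mathcal L$-ontologies $\mathcal O_1,\mathcal O_2$ and $\mathcal L$-concepts $C_1,C_2$ with $\mathcal O_1\cup\mathcal O_2\models C_1\sqsubseteq C_2$ an $\mathcal L$-interpolant exists. An explicit $\mathcal L(\Sigma)$-definition of a concept name $A$ under $\mathcal O$ is an $\mathcal L$-concept $C$ with $\mathrm{sig}(C)\subseteq\Sigma$ and $\mathcal O\models A\equiv C$. $A$ is implicitly definable using $\Sigma$ under $\mathcal O$ if for all models $\mathcal I,\mathcal J$ of $\mathcal O$ whose restrictions to the symbols in $\Sigma$ coincide (same domain and same interpretation of all symbols of $\Sigma$) we have $A^{\mathcal I}=A^{\mathcal J}$. $\mathcal L$ has the PBDP if for every $\mathcal L$-ontology $\mathcal O$, concept name $A$ and signature $\Sigma\subseteq\mathrm{sig}(\mathcal O)$, implicit definability of $A$ using $\Sigma$ under $\mathcal O$ implies explicit $\mathcal L(\Sigma)$-definability of $A$ under $\mathcal O$. -}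

module Defs where

open import Data.Nat using (ℕ)
open import Data.Bool using (Bool; true; false; T)
open import Data.List using (List; []; _∷_; _++_)
open import Data.List.Membership.Propositional using (_∈_)
open import Data.Product using (Σ; _×_; _,_)
open import Data.Sum using (_⊎_)
open import Data.Unit using (⊤)
open import Data.Empty using (⊥)
open import Relation.Binary.PropositionalEquality using (_≡_)
open import Relation.Nullary using (¬_)
open import Function.Bundles using (_⇔_)

-- Syntax.  N_C, N_R, N_I are each identified with ℕ (countably infinite,
-- disjoint because they live in different constructors).

data Role : Set where
  name : ℕ → Role
  inv  : ℕ → Role
  univ : Role

data Concept : Set where
  top     : Concept
  atom    : ℕ → Concept
  nominal : ℕ → Concept
  _⊓_     : Concept → Concept → Concept
  ex      : Role → Concept → Concept

-- Axioms: concept inclusions C ⊑ D and role inclusions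
-- r₁ ∘ r₂ ∘ … ∘ rₙ ⊑ r  (n ≥ 1), written  RI r₁ [r₂ … rₙ] r.
data Axiom : Set where
  CI : Concept → Concept → Axiom
  RI : ℕ → List ℕ → ℕ → Axiom

Ontology : Set
Ontology = List Axiom

-- Semantics.  An interpretation has a non-empty domain (a chosen
-- element witnesses non-emptiness).

record Structure (Δ : Set) : Set₁ where
  field
    cn : ℕ → Δ → Set
    rn : ℕ → Δ → Δ → Set
    ind : ℕ → Δ

open Structure public

record Interpretation : Set₁ where
  field
    Dom : Set
    point : Dom
    str : Structure Dom

open Interpretation public

module _ {Δ : Set} (I : Structure Δ) where

  roleI : Role → Δ → Δ → Set
  roleI (name r) d e = rn I r d e
  roleI (inv r)  d e = rn I r e d
  roleI univ     d e = ⊤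

  ⟦_⟧ : Concept → Δ → Set
  ⟦ top ⟧ d = ⊤
  ⟦ atom A ⟧ d = cn I A d
  ⟦ nominal a ⟧ d = d ≡ ind I a
  ⟦ C ⊓ D ⟧ d = ⟦ C ⟧ d × ⟦ D ⟧ d
  ⟦ ex r C ⟧ d = Σ Δ λ e → roleI r d e × ⟦ C ⟧ e

  Chain : List ℕ → Δ → Δ → Set
  Chain [] d e = d ≡ e
  Chain (r ∷ rs) d e = Σ Δ λ m → rn I r d m × Chain rs m e

  SatAx : Axiom → Set
  SatAx (CI C D) = ∀ d → ⟦ C ⟧ d → ⟦ D ⟧ d
  SatAx (RI r rs s) = ∀ d e → Chain (r ∷ rs) d e → rn I s d e

  IsModel : Ontology → Set
  IsModel O = ∀ {α} → α ∈ O → SatAx α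

_⊨_⊑_ : Ontology → Concept → Concept → Set₁
O ⊨ C ⊑ D = (I : Interpretation) → IsModel (str I) O →
            ∀ d → ⟦ str I ⟧ C d → ⟦ str I ⟧ D d

_⊨_≡ᶜ_ : Ontology → Concept → Concept → Set₁
O ⊨ C ≡ᶜ D = (O ⊨ C ⊑ D) × (O ⊨ D ⊑ C)

-- Signatures (u is not a symbol).

data Symbol : Set where
  cSym : ℕ → Symbol
  rSym : ℕ → Symbol
  iSym : ℕ → Symbol

sigRole : Role → List Symbol
sigRole (name r) = rSym r ∷ []
sigRole (inv r)  = rSym r ∷ []
sigRole univ     = []

sigC : Concept → List Symbol
sigC top = []
sigC (atom A) = cSym A ∷ []
sigC (nominal a) = iSym a ∷ []
sigC (C ⊓ D) = sigC C ++ sigC D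
sigC (ex r C) = sigRole r ++ sigC C

rSyms : List ℕ → List Symbol
rSyms [] = []
rSyms (r ∷ rs) = rSym r ∷ rSyms rs

sigAx : Axiom → List Symbol
sigAx (CI C D) = sigC C ++ sigC D
sigAx (RI r rs s) = rSym r ∷ rSyms rs ++ rSym s ∷ []

sigO : Ontology → List Symbol
sigO [] = []
sigO (α ∷ O) = sigAx α ++ sigO O

sigOC : Ontology → Concept → List Symbol
sigOC O C = sigO O ++ sigC C

_⊆ˢ_ : List Symbol → List Symbol → Set
X ⊆ˢ Y = ∀ {x} → x ∈ X → x ∈ Y

record Features : Set where
  constructor feats
  field
    nomF : Bool
    invF : Bool
    univF : Bool

RoleIn : Features → Role → Set
RoleIn f (name _) = ⊤
RoleIn f (inv _) = T (Features.invF f)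
RoleIn f univ = T (Features.univF f)

ConceptIn : Features → Concept → Set
ConceptIn f top = ⊤
ConceptIn f (atom _) = ⊤
ConceptIn f (nominal _) = T (Features.nomF f)
ConceptIn f (C ⊓ D) = ConceptIn f C × ConceptIn f D
ConceptIn f (ex r C) = RoleIn f r × ConceptIn f C

EL ELu ELO ELOu ELI ELIu : Features
EL   = feats false false false
ELu  = feats false false true
ELO  = feats true  false false
ELOu = feats true  false true
ELI  = feats false true  false
ELIu = feats false true  true

IsCIof : Features → Axiom → Set
IsCIof f (CI C D) = ConceptIn f C × ConceptIn f D
IsCIof f (RI _ _ _) = ⊥

CIOntology : Features → Ontology → Set
CIOntology f O = ∀ {α} → α ∈ O → IsCIof f α

ELSingleRI : Ontology → Set
ELSingleRI O = Σ ℕ λ r → Σ ℕ λ s →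
  ∀ {α} → α ∈ O → IsCIof EL α ⊎ (α ≡ RI r (s ∷ []) s)

ELHTrans : Ontology → Set
ELHTrans O = Σ ℕ λ t →
  ∀ {α} → α ∈ O →
    IsCIof EL α ⊎ (Σ ℕ λ r → Σ ℕ λ s → α ≡ RI r [] s) ⊎ (α ≡ RI t (t ∷ []) t)

-- Ont  : which ontologies belong to the logic
--   Conc : which concepts belong to the logic (for C₁, C₂)
--   Tgt  : the language in which interpolants / explicit definitions
--          are sought

IsInterpolant : (Concept → Set) → Ontology → Ontology → Concept → Concept →
                Concept → Set₁
IsInterpolant Tgt O₁ O₂ C₁ C₂ D =
  Tgt D ×
  (∀ {x} → x ∈ sigC D → x ∈ sigOC O₁ C₁ × x ∈ sigOC O₂ C₂) ×
  ((O₁ ++ O₂) ⊨ C₁ ⊑ D) ×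
  ((O₁ ++ O₂) ⊨ D ⊑ C₂)

HasCIP : (Ontology → Set) → (Concept → Set) → (Concept → Set) → Set₁
HasCIP Ont Conc Tgt =
  ∀ O₁ O₂ C₁ C₂ → Ont O₁ → Ont O₂ → Conc C₁ → Conc C₂ →
  (O₁ ++ O₂) ⊨ C₁ ⊑ C₂ →
  Σ Concept λ D → IsInterpolant Tgt O₁ O₂ C₁ C₂ D

AgreeOn : {Δ : Set} → List Symbol → Structure Δ → Structure Δ → Set
AgreeOn {Δ} Sg I J =
  (∀ A → cSym A ∈ Sg → ∀ d → cn I A d ⇔ cn J A d) ×
  (∀ r → rSym r ∈ Sg → ∀ d e → rn I r d e ⇔ rn J r d e) ×
  (∀ a → iSym a ∈ Sg → ind I a ≡ ind J a)

ImplicitlyDefinable : Ontology → ℕ → List Symbol → Set₁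
ImplicitlyDefinable O A Sg =
  (Δ : Set) → Δ → (I J : Structure Δ) → IsModel I O → IsModel J O →
  AgreeOn Sg I J → ∀ d → cn I A d ⇔ cn J A d

ExplicitDefinition : (Concept → Set) → Ontology → ℕ → List Symbol →
                     Concept → Set₁
ExplicitDefinition Tgt O A Sg C =
  Tgt C × (sigC C ⊆ˢ Sg) × (O ⊨ atom A ≡ᶜ C)

HasPBDP : (Ontology → Set) → (Concept → Set) → Set₁
HasPBDP Ont Tgt =
  ∀ O A Sg → Ont O → Sg ⊆ˢ sigO O → ImplicitlyDefinable O A Sg →
  Σ Concept λ C → ExplicitDefinition Tgt O A Sg C

FailsBoth : (Ontology → Set) → (Concept → Set) → (Concept → Set) → Set₁
FailsBoth Ont Conc Tgt = ¬ HasCIP Ont Conc Tgt × ¬ HasPBDP Ont Tgt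

{-# OPTIONS --safe #-}

-- In each logic there are an ontology O, a signature Sg and a concept name A that is implicitly
-- definable from Sg under O. Let O′ be O with every symbol outside Sg primed. Implicit
-- definability gives O ∪ O′ ⊨ A ⊑ A′, and an interpolant for it, like an explicit definition of A,
-- would be an Sg-concept lying between A and A′. Two models of O ∪ O′ rule this out: an
-- Sg-simulation (matching the constructors of the target language) runs from a point in A to a
-- point outside A′, and simulations preserve such concepts.

module Submission where

open import Defs
open import Data.Bool using (T; true; false)
open import Data.Empty using (⊥)
open import Data.List using (List; []; _∷_; _++_; map)
open import Data.List.Membership.Propositional using (_∈_)
open import Data.List.Membership.Propositional.Properties using (∈-++⁺ˡ; ∈-++⁺ʳ; ∈-++⁻; ∈-map⁺; ∈-map⁻)
open import Data.List.Relation.Unary.All as All using (All; []; _∷_; all?)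
open import Data.List.Relation.Unary.Any using (here; there)
open import Data.Nat using (ℕ; _+_; _%_; _≟_)
open import Data.Nat.DivMod using ([m+n]%n≡m%n)
open import Data.Product using (∃-syntax; _×_; _,_; proj₁; proj₂)
import Data.Sum as Sum
open import Data.Sum using (inj₁; inj₂)
open import Data.Unit using (⊤; tt)
open import Function using (id)
open import Function.Bundles using (_⇔_; mk⇔; Equivalence)
import Function.Properties.Equivalence as ⇔
open import Relation.Binary.Definitions using (DecidableEquality)
open import Relation.Binary.PropositionalEquality using (_≡_; refl; sym; trans; cong; subst)
open import Relation.Nullary using (¬_; Dec; yes; no; contradiction)
open import Relation.Nullary.Decidable using (map′; _→-dec_; toWitness)

open Features

_≟ˢ_ : DecidableEquality Symbol
cSym a ≟ˢ cSym b = map′ (cong cSym) (λ { refl → refl }) (a ≟ b)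
rSym a ≟ˢ rSym b = map′ (cong rSym) (λ { refl → refl }) (a ≟ b)
iSym a ≟ˢ iSym b = map′ (cong iSym) (λ { refl → refl }) (a ≟ b)
cSym _ ≟ˢ rSym _ = no λ ()
cSym _ ≟ˢ iSym _ = no λ ()
rSym _ ≟ˢ cSym _ = no λ ()
rSym _ ≟ˢ iSym _ = no λ ()
iSym _ ≟ˢ cSym _ = no λ ()
iSym _ ≟ˢ rSym _ = no λ ()

open import Data.List.Membership.DecPropositional _≟ˢ_ using (_∈?_)
open import Data.List.Relation.Binary.Subset.DecPropositional _≟ˢ_ using (_⊆?_)

SharedSymbols⊆ : List Symbol → List Symbol → List Symbol → Set
SharedSymbols⊆ X Y Sg = ∀ {x} → x ∈ X → x ∈ Y → x ∈ Sg

sharedSymbols⊆? : ∀ X Y Sg → Dec (SharedSymbols⊆ X Y Sg)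
sharedSymbols⊆? X Y Sg =
  map′ (λ all x∈X → All.lookup all x∈X) All.tabulate (all? (λ x → x ∈? Y →-dec x ∈? Sg) X)

_≤ᶠ_ : Features → Features → Set
f ≤ᶠ g = (T (nomF f) → T (nomF g)) × (T (invF f) → T (invF g)) × (T (univF f) → T (univF g))

ConceptIn-mono : ∀ {f g} → f ≤ᶠ g → ∀ C → ConceptIn f C → ConceptIn g C
ConceptIn-mono f≤g top _ = tt
ConceptIn-mono f≤g (atom _) _ = tt
ConceptIn-mono (nom≤ , _) (nominal _) p = nom≤ p
ConceptIn-mono f≤g (C ⊓ D) (p , q) = ConceptIn-mono f≤g C p , ConceptIn-mono f≤g D q
ConceptIn-mono f≤g (ex (name _) C) (_ , q) = tt , ConceptIn-mono f≤g C q
ConceptIn-mono f≤g@(_ , inv≤ , _) (ex (inv _) C) (p , q) = inv≤ p , ConceptIn-mono f≤g C q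
ConceptIn-mono f≤g@(_ , _ , univ≤) (ex univ C) (p , q) = univ≤ p , ConceptIn-mono f≤g C q

FailsBoth-antitone : ∀ {Ont Conc} {Tgt Tgt′ : Concept → Set} → (∀ {C} → Tgt C → Tgt′ C) →
  FailsBoth Ont Conc Tgt′ → FailsBoth Ont Conc Tgt
FailsBoth-antitone Tgt⊆Tgt′ (¬cip , ¬pbdp) =
  (λ cip → ¬cip λ O₁ O₂ C₁ C₂ o₁ o₂ c₁ c₂ entails →
     let D , D∈Tgt , rest = cip O₁ O₂ C₁ C₂ o₁ o₂ c₁ c₂ entails in D , Tgt⊆Tgt′ D∈Tgt , rest) ,
  (λ pbdp → ¬pbdp λ O A Sg o Sg⊆ implicit →
     let C , C∈Tgt , rest = pbdp O A Sg o Sg⊆ implicit in C , Tgt⊆Tgt′ C∈Tgt , rest)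

FailsBoth-withoutUniv : ∀ {Ont Conc n i} →
  FailsBoth Ont Conc (ConceptIn (feats n i true)) → FailsBoth Ont Conc (ConceptIn (feats n i false))
FailsBoth-withoutUniv = FailsBoth-antitone λ {C} → ConceptIn-mono (id , id , λ ()) C

record Renaming : Set where
  field
    concept role individual : ℕ → ℕ

open Renaming

renameRole : Renaming → Role → Role
renameRole ρ (name r) = name (role ρ r)
renameRole ρ (inv r) = inv (role ρ r)
renameRole ρ univ = univ

renameC : Renaming → Concept → Concept
renameC ρ top = top
renameC ρ (atom A) = atom (concept ρ A)
renameC ρ (nominal a) = nominal (individual ρ a)
renameC ρ (C ⊓ D) = renameC ρ C ⊓ renameC ρ D
renameC ρ (ex r C) = ex (renameRole ρ r) (renameC ρ C)

renameAx : Renaming → Axiom → Axiom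
renameAx ρ (CI C D) = CI (renameC ρ C) (renameC ρ D)
renameAx ρ (RI r rs s) = RI (role ρ r) (map (role ρ) rs) (role ρ s)

renameO : Renaming → Ontology → Ontology
renameO ρ = map (renameAx ρ)

reduct : ∀ {Δ} → Renaming → Structure Δ → Structure Δ
reduct ρ I = record
  { cn = λ A → cn I (concept ρ A)
  ; rn = λ r → rn I (role ρ r)
  ; ind = λ a → ind I (individual ρ a)
  }

module _ (ρ : Renaming) {Δ : Set} (I : Structure Δ) where

  reduct-⟦⟧⁺ : ∀ C {d} → ⟦ reduct ρ I ⟧ C d → ⟦ I ⟧ (renameC ρ C) d
  reduct-⟦⟧⁺ top p = p
  reduct-⟦⟧⁺ (atom _) p = p
  reduct-⟦⟧⁺ (nominal _) p = p
  reduct-⟦⟧⁺ (C ⊓ D) (p , q) = reduct-⟦⟧⁺ C p , reduct-⟦⟧⁺ D q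
  reduct-⟦⟧⁺ (ex (name _) C) (e , de , p) = e , de , reduct-⟦⟧⁺ C p
  reduct-⟦⟧⁺ (ex (inv _) C) (e , de , p) = e , de , reduct-⟦⟧⁺ C p
  reduct-⟦⟧⁺ (ex univ C) (e , de , p) = e , de , reduct-⟦⟧⁺ C p

  reduct-⟦⟧⁻ : ∀ C {d} → ⟦ I ⟧ (renameC ρ C) d → ⟦ reduct ρ I ⟧ C d
  reduct-⟦⟧⁻ top p = p
  reduct-⟦⟧⁻ (atom _) p = p
  reduct-⟦⟧⁻ (nominal _) p = p
  reduct-⟦⟧⁻ (C ⊓ D) (p , q) = reduct-⟦⟧⁻ C p , reduct-⟦⟧⁻ D q
  reduct-⟦⟧⁻ (ex (name _) C) (e , de , p) = e , de , reduct-⟦⟧⁻ C p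
  reduct-⟦⟧⁻ (ex (inv _) C) (e , de , p) = e , de , reduct-⟦⟧⁻ C p
  reduct-⟦⟧⁻ (ex univ C) (e , de , p) = e , de , reduct-⟦⟧⁻ C p

  reduct-Chain⁺ : ∀ rs {d e} → Chain (reduct ρ I) rs d e → Chain I (map (role ρ) rs) d e
  reduct-Chain⁺ [] d≡e = d≡e
  reduct-Chain⁺ (r ∷ rs) (m , dm , me) = m , dm , reduct-Chain⁺ rs me

  reduct-Chain⁻ : ∀ rs {d e} → Chain I (map (role ρ) rs) d e → Chain (reduct ρ I) rs d e
  reduct-Chain⁻ [] d≡e = d≡e
  reduct-Chain⁻ (r ∷ rs) (m , dm , me) = m , dm , reduct-Chain⁻ rs me

  reduct-SatAx⁺ : ∀ α → SatAx (reduct ρ I) α → SatAx I (renameAx ρ α)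
  reduct-SatAx⁺ (CI C D) C⊑D d p = reduct-⟦⟧⁺ D (C⊑D d (reduct-⟦⟧⁻ C p))
  reduct-SatAx⁺ (RI r rs s) ri d e chain = ri d e (reduct-Chain⁻ (r ∷ rs) chain)

  reduct-SatAx⁻ : ∀ α → SatAx I (renameAx ρ α) → SatAx (reduct ρ I) α
  reduct-SatAx⁻ (CI C D) C⊑D d p = reduct-⟦⟧⁻ D (C⊑D d (reduct-⟦⟧⁺ C p))
  reduct-SatAx⁻ (RI r rs s) ri d e chain = ri d e (reduct-Chain⁺ (r ∷ rs) chain)

  reduct-isModel⁺ : ∀ {O} → IsModel (reduct ρ I) O → IsModel I (renameO ρ O)
  reduct-isModel⁺ I⊨O α∈ with ∈-map⁻ (renameAx ρ) α∈
  ... | α , α∈O , refl = reduct-SatAx⁺ α (I⊨O α∈O)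

  reduct-isModel⁻ : ∀ {O} → IsModel I (renameO ρ O) → IsModel (reduct ρ I) O
  reduct-isModel⁻ I⊨ρO α∈O = reduct-SatAx⁻ _ (I⊨ρO (∈-map⁺ (renameAx ρ) α∈O))

module _ (ρ : Renaming) where

  ConceptIn-rename : ∀ {f} C → ConceptIn f C → ConceptIn f (renameC ρ C)
  ConceptIn-rename top p = p
  ConceptIn-rename (atom _) p = p
  ConceptIn-rename (nominal _) p = p
  ConceptIn-rename (C ⊓ D) (p , q) = ConceptIn-rename C p , ConceptIn-rename D q
  ConceptIn-rename (ex (name _) C) (p , q) = p , ConceptIn-rename C q
  ConceptIn-rename (ex (inv _) C) (p , q) = p , ConceptIn-rename C q
  ConceptIn-rename (ex univ C) (p , q) = p , ConceptIn-rename C q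

  IsCIof-rename : ∀ {f} α → IsCIof f α → IsCIof f (renameAx ρ α)
  IsCIof-rename (CI C D) (p , q) = ConceptIn-rename C p , ConceptIn-rename D q

  renameO-preserves : {P Q : Axiom → Set} → (∀ {α} → P α → Q (renameAx ρ α)) →
    ∀ {O} → (∀ {α} → α ∈ O → P α) → ∀ {α} → α ∈ renameO ρ O → Q α
  renameO-preserves P⇒Q {O} all-P α∈ with ∈-map⁻ (renameAx ρ) α∈
  ... | α , α∈O , refl = P⇒Q (all-P α∈O)

  CIOntology-rename : ∀ {f O} → CIOntology f O → CIOntology f (renameO ρ O)
  CIOntology-rename = renameO-preserves (IsCIof-rename _)

  ELSingleRI-rename : ∀ {O} → ELSingleRI O → ELSingleRI (renameO ρ O)
  ELSingleRI-rename (r , s , h) =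
    role ρ r , role ρ s , renameO-preserves (Sum.map (IsCIof-rename _) (cong (renameAx ρ))) h

  ELHTrans-rename : ∀ {O} → ELHTrans O → ELHTrans (renameO ρ O)
  ELHTrans-rename (t , h) =
    role ρ t ,
    renameO-preserves
      (Sum.map (IsCIof-rename _)
        (Sum.map (λ (r , s , eq) → role ρ r , role ρ s , cong (renameAx ρ) eq) (cong (renameAx ρ))))
      h

record _≈ˢ_ {Δ : Set} (I J : Structure Δ) : Set₁ where
  field
    cn-≡ : ∀ A → cn I A ≡ cn J A
    rn-≡ : ∀ r → rn I r ≡ rn J r
    ind-≡ : ∀ a → ind I a ≡ ind J a

module _ {Δ : Set} {I J : Structure Δ} where

  ≈ˢ-sym : I ≈ˢ J → J ≈ˢ I
  ≈ˢ-sym I≈J = record { cn-≡ = λ A → sym (cn-≡ A) ; rn-≡ = λ r → sym (rn-≡ r) ; ind-≡ = λ a → sym (ind-≡ a) }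
    where open _≈ˢ_ I≈J

  ≈ˢ-roleI : I ≈ˢ J → ∀ r {d e} → roleI I r d e → roleI J r d e
  ≈ˢ-roleI I≈J (name r) = subst (λ R → R _ _) (_≈ˢ_.rn-≡ I≈J r)
  ≈ˢ-roleI I≈J (inv r) = subst (λ R → R _ _) (_≈ˢ_.rn-≡ I≈J r)
  ≈ˢ-roleI I≈J univ = id

  ≈ˢ-⟦⟧ : I ≈ˢ J → ∀ C {d} → ⟦ I ⟧ C d → ⟦ J ⟧ C d
  ≈ˢ-⟦⟧ I≈J top p = p
  ≈ˢ-⟦⟧ I≈J (atom A) p = subst (λ P → P _) (_≈ˢ_.cn-≡ I≈J A) p
  ≈ˢ-⟦⟧ I≈J (nominal a) p = trans p (_≈ˢ_.ind-≡ I≈J a)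
  ≈ˢ-⟦⟧ I≈J (C ⊓ D) (p , q) = ≈ˢ-⟦⟧ I≈J C p , ≈ˢ-⟦⟧ I≈J D q
  ≈ˢ-⟦⟧ I≈J (ex r C) (e , de , p) = e , ≈ˢ-roleI I≈J r de , ≈ˢ-⟦⟧ I≈J C p

  ≈ˢ-Chain : I ≈ˢ J → ∀ rs {d e} → Chain I rs d e → Chain J rs d e
  ≈ˢ-Chain I≈J [] d≡e = d≡e
  ≈ˢ-Chain I≈J (r ∷ rs) (m , dm , me) = m , ≈ˢ-roleI I≈J (name r) dm , ≈ˢ-Chain I≈J rs me

≈ˢ-SatAx : ∀ {Δ} {I J : Structure Δ} → I ≈ˢ J → ∀ α → SatAx I α → SatAx J α
≈ˢ-SatAx I≈J (CI C D) C⊑D d p = ≈ˢ-⟦⟧ I≈J D (C⊑D d (≈ˢ-⟦⟧ (≈ˢ-sym I≈J) C p))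
≈ˢ-SatAx I≈J (RI r rs s) ri d e chain =
  ≈ˢ-roleI I≈J (name s) (ri d e (≈ˢ-Chain (≈ˢ-sym I≈J) (r ∷ rs) chain))

≈ˢ-isModel : ∀ {Δ} {I J : Structure Δ} {O} → I ≈ˢ J → IsModel I O → IsModel J O
≈ˢ-isModel I≈J I⊨O α∈O = ≈ˢ-SatAx I≈J _ (I⊨O α∈O)

IsModel-++ : ∀ {Δ} {I : Structure Δ} {O₁ O₂} → IsModel I O₁ → IsModel I O₂ → IsModel I (O₁ ++ O₂)
IsModel-++ {O₁ = O₁} I⊨O₁ I⊨O₂ α∈ = Sum.[ I⊨O₁ , I⊨O₂ ]′ (∈-++⁻ O₁ α∈)

-- Priming adds 10 to an index. The examples use indices below 10, so primed symbols are fresh,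
-- and structures built with modulo10 interpret a primed symbol like its original.
prime : List Symbol → (ℕ → Symbol) → ℕ → ℕ
prime Sg sym n with sym n ∈? Sg
... | yes _ = n
... | no _ = n + 10

prime-fixes : ∀ Sg sym {n} → sym n ∈ Sg → prime Sg sym n ≡ n
prime-fixes Sg sym {n} n∈Sg with sym n ∈? Sg
... | yes _ = refl
... | no n∉Sg = contradiction n∈Sg n∉Sg

prime-%10 : ∀ Sg sym n → prime Sg sym n % 10 ≡ n % 10
prime-%10 Sg sym n with sym n ∈? Sg
... | yes _ = refl
... | no _ = [m+n]%n≡m%n n 10

primeOutside : List Symbol → Renaming
primeOutside Sg = record { concept = prime Sg cSym ; role = prime Sg rSym ; individual = prime Sg iSym }

primedCopy : List Symbol → Ontology → Ontology
primedCopy Sg = renameO (primeOutside Sg)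

modulo10 : ∀ {Δ} → Structure Δ → Structure Δ
modulo10 B = record { cn = λ A → cn B (A % 10) ; rn = λ r → rn B (r % 10) ; ind = λ a → ind B (a % 10) }

modulo10-≈-reduct : ∀ {Δ} Sg (B : Structure Δ) → modulo10 B ≈ˢ reduct (primeOutside Sg) (modulo10 B)
modulo10-≈-reduct Sg B = record
  { cn-≡ = λ A → cong (cn B) (sym (prime-%10 Sg cSym A))
  ; rn-≡ = λ r → cong (rn B) (sym (prime-%10 Sg rSym r))
  ; ind-≡ = λ a → cong (ind B) (sym (prime-%10 Sg iSym a))
  }

modulo10-isModel-withCopy : ∀ {Δ} Sg (B : Structure Δ) {O} →
  IsModel (modulo10 B) O → IsModel (modulo10 B) (O ++ primedCopy Sg O)
modulo10-isModel-withCopy Sg B M⊨O =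
  IsModel-++ M⊨O (reduct-isModel⁺ (primeOutside Sg) (modulo10 B) (≈ˢ-isModel (modulo10-≈-reduct Sg B) M⊨O))

≡⇒⇔ : ∀ {X : Set} (P : X → Set) {m n} → m ≡ n → P m ⇔ P n
≡⇒⇔ P refl = ⇔.refl

AgreeOn-sym : ∀ {Δ} {Sg} {I J : Structure Δ} → AgreeOn Sg I J → AgreeOn Sg J I
AgreeOn-sym (cn⇔ , rn⇔ , ind≡) =
  (λ A A∈ d → ⇔.sym (cn⇔ A A∈ d)) , (λ r r∈ d e → ⇔.sym (rn⇔ r r∈ d e)) , (λ a a∈ → sym (ind≡ a a∈))

AgreeOn-reduct-primeOutside : ∀ {Δ} Sg (I : Structure Δ) → AgreeOn Sg I (reduct (primeOutside Sg) I)
AgreeOn-reduct-primeOutside Sg I =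
  (λ A A∈ d → ≡⇒⇔ (λ B → cn I B d) (sym (prime-fixes Sg cSym A∈))) ,
  (λ r r∈ d e → ≡⇒⇔ (λ s → rn I s d e) (sym (prime-fixes Sg rSym r∈))) ,
  (λ a a∈ → cong (ind I) (sym (prime-fixes Sg iSym a∈)))

TransfersAlong : Ontology → ℕ → List Symbol → Set₁
TransfersAlong O A Sg =
  ∀ {Δ} (I J : Structure Δ) → IsModel I O → IsModel J O → AgreeOn Sg I J → ∀ d → cn I A d → cn J A d

implicitlyDefinable : ∀ {O A Sg} → TransfersAlong O A Sg → ImplicitlyDefinable O A Sg
implicitlyDefinable transfer Δ _ I J I⊨O J⊨O I≈J d =
  mk⇔ (transfer I J I⊨O J⊨O I≈J d) (transfer J I J⊨O I⊨O (AgreeOn-sym I≈J) d)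

-- A model of O and its primed copy yields, through the reduct, a second model of O that agrees
-- with the first on Sg and interprets A as the first interprets A′.
implicitlyDefinable⇒⊑primed : ∀ {O A Sg} → ImplicitlyDefinable O A Sg →
  (O ++ primedCopy Sg O) ⊨ atom A ⊑ atom (prime Sg cSym A)
implicitlyDefinable⇒⊑primed {O} {A} {Sg} implicit I I⊨ d =
  Equivalence.to
    (implicit (Dom I) d (str I) (reduct ρ (str I))
      (λ α∈O → I⊨ (∈-++⁺ˡ α∈O))
      (reduct-isModel⁻ ρ (str I) (λ α∈ → I⊨ (∈-++⁺ʳ O α∈)))
      (AgreeOn-reduct-primeOutside Sg (str I)) d)
  where
  ρ : Renaming
  ρ = primeOutside Sg

record Simulation (f : Features) (Sg : List Symbol) {Δ₁ Δ₂ : Set}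
                  (I : Structure Δ₁) (K : Structure Δ₂) : Set₁ where
  field
    _∼_ : Δ₁ → Δ₂ → Set
    atom-∼ : ∀ {A d e} → cSym A ∈ Sg → d ∼ e → cn I A d → cn K A e
    nominal-∼ : T (nomF f) → ∀ {a d e} → iSym a ∈ Sg → d ∼ e → d ≡ ind I a → e ≡ ind K a
    forth : ∀ {r d e d′} → rSym r ∈ Sg → d ∼ e → rn I r d d′ → ∃[ e′ ] rn K r e e′ × d′ ∼ e′
    back : T (invF f) → ∀ {r d e d′} → rSym r ∈ Sg → d ∼ e → rn I r d′ d → ∃[ e′ ] rn K r e′ e × d′ ∼ e′
    total : T (univF f) → ∀ d → ∃[ e ] d ∼ e

module _ {f Sg Δ₁ Δ₂} {I : Structure Δ₁} {K : Structure Δ₂} (Z : Simulation f Sg I K) where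
  open Simulation Z

  simulation-preserves : ∀ C → ConceptIn f C → sigC C ⊆ˢ Sg → ∀ {d e} → d ∼ e → ⟦ I ⟧ C d → ⟦ K ⟧ C e
  simulation-preserves top _ _ _ _ = tt
  simulation-preserves (atom A) _ C⊆ d∼e p = atom-∼ (C⊆ (here refl)) d∼e p
  simulation-preserves (nominal a) nom C⊆ d∼e p = nominal-∼ nom (C⊆ (here refl)) d∼e p
  simulation-preserves (C ⊓ D) (C∈f , D∈f) C⊆ d∼e (p , q) =
    simulation-preserves C C∈f (λ x∈ → C⊆ (∈-++⁺ˡ x∈)) d∼e p ,
    simulation-preserves D D∈f (λ x∈ → C⊆ (∈-++⁺ʳ (sigC C) x∈)) d∼e q
  simulation-preserves (ex (name r) C) (_ , C∈f) C⊆ d∼e (d′ , dd′ , p) =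
    let e′ , ee′ , d′∼e′ = forth (C⊆ (here refl)) d∼e dd′
    in e′ , ee′ , simulation-preserves C C∈f (λ x∈ → C⊆ (there x∈)) d′∼e′ p
  simulation-preserves (ex (inv r) C) (inv∈f , C∈f) C⊆ d∼e (d′ , d′d , p) =
    let e′ , e′e , d′∼e′ = back inv∈f (C⊆ (here refl)) d∼e d′d
    in e′ , e′e , simulation-preserves C C∈f (λ x∈ → C⊆ (there x∈)) d′∼e′ p
  simulation-preserves (ex univ C) (univ∈f , C∈f) C⊆ _ (d′ , _ , p) =
    let e′ , d′∼e′ = total univ∈f d′
    in e′ , tt , simulation-preserves C C∈f C⊆ d′∼e′ p

-- Every Sg-concept holds at such a point x.
saturatedPointSimulation : ∀ {f Sg Δ₁ Δ₂} {I : Structure Δ₁} {K : Structure Δ₂} (x : Δ₂) →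
  (∀ {A} → cSym A ∈ Sg → cn K A x) → (∀ {r} → rSym r ∈ Sg → rn K r x x) →
  (∀ {a} → iSym a ∈ Sg → x ≡ ind K a) → Simulation f Sg I K
saturatedPointSimulation x x∈A x-loop x-named = record
  { _∼_ = λ _ e → e ≡ x
  ; atom-∼ = λ { A∈ refl _ → x∈A A∈ }
  ; nominal-∼ = λ { _ a∈ refl _ → x-named a∈ }
  ; forth = λ { r∈ refl _ → x , x-loop r∈ , refl }
  ; back = λ { _ r∈ refl _ → x , x-loop r∈ , refl }
  ; total = λ _ _ → x , refl
  }

everything : Structure ⊤
everything = record { cn = λ _ _ → ⊤ ; rn = λ _ _ _ → ⊤ ; ind = λ _ → tt }

everything-⟦⟧ : ∀ C → ⟦ everything ⟧ C tt
everything-⟦⟧ top = tt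
everything-⟦⟧ (atom _) = tt
everything-⟦⟧ (nominal _) = refl
everything-⟦⟧ (C ⊓ D) = everything-⟦⟧ C , everything-⟦⟧ D
everything-⟦⟧ (ex (name _) C) = tt , tt , everything-⟦⟧ C
everything-⟦⟧ (ex (inv _) C) = tt , tt , everything-⟦⟧ C
everything-⟦⟧ (ex univ C) = tt , tt , everything-⟦⟧ C

everything-isModel : ∀ {O} → IsModel everything O
everything-isModel {α = CI C D} _ tt _ = everything-⟦⟧ D
everything-isModel {α = RI _ _ _} _ _ _ _ = tt

pointed : ∀ {Δ} → Structure Δ → Δ → Interpretation
pointed {Δ} I d = record { Dom = Δ ; point = d ; str = I }

record Separation (f : Features) (Sg : List Symbol) (O : Ontology) (A A′ : ℕ) : Set₁ where
  field
    Δ₁ Δ₂ : Set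
    I : Structure Δ₁
    K : Structure Δ₂
    I⊨O : IsModel I O
    K⊨O : IsModel K O
    simulation : Simulation f Sg I K
    d : Δ₁
    e : Δ₂
    d∼e : Simulation._∼_ simulation d e
    d∈A : cn I A d
    e∉A′ : ¬ cn K A′ e

separation-noConceptBetween : ∀ {f Sg O A A′} → Separation f Sg O A A′ →
  ∀ D → ConceptIn f D → sigC D ⊆ˢ Sg → O ⊨ atom A ⊑ D → O ⊨ D ⊑ atom A′ → ⊥
separation-noConceptBetween sep D D∈f D⊆Sg A⊑D D⊑A′ =
  e∉A′ (D⊑A′ (pointed K e) K⊨O e
         (simulation-preserves simulation D D∈f D⊆Sg d∼e (A⊑D (pointed I d) I⊨O d d∈A)))
  where open Separation sep

separationAtSaturatedPoint : ∀ {f Sg O A A′ Δ} (K : Structure Δ) (x : Δ) → IsModel K O → ¬ cn K A′ x →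
  (∀ {B} → cSym B ∈ Sg → cn K B x) → (∀ {r} → rSym r ∈ Sg → rn K r x x) →
  (∀ {a} → iSym a ∈ Sg → x ≡ ind K a) → Separation f Sg O A A′
separationAtSaturatedPoint K x K⊨O x∉A′ x∈B x-loop x-named = record
  { I = everything ; K = K ; I⊨O = everything-isModel ; K⊨O = K⊨O
  ; simulation = saturatedPointSimulation x x∈B x-loop x-named
  ; d = tt ; e = x ; d∼e = refl ; d∈A = tt ; e∉A′ = x∉A′
  }

record BethCounterexample (Ont : Ontology → Set) (f : Features) : Set₁ where
  field
    Sg : List Symbol
    O : Ontology
    A : ℕ
    O∈logic : Ont O
    copy∈logic : Ont (primedCopy Sg O)
    Sg⊆sigO : Sg ⊆ˢ sigO O
    shared⊆Sg : SharedSymbols⊆ (sigOC O (atom A)) (sigOC (primedCopy Sg O) (atom (prime Sg cSym A))) Sg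
    implicit : ImplicitlyDefinable O A Sg
    separation : Separation f Sg (O ++ primedCopy Sg O) A (prime Sg cSym A)

⊨-++ˡ : ∀ {O O′ C D} → O ⊨ C ⊑ D → (O ++ O′) ⊨ C ⊑ D
⊨-++ˡ O⊨C⊑D I I⊨ = O⊨C⊑D I (λ α∈O → I⊨ (∈-++⁺ˡ α∈O))

⊨-trans : ∀ {O C D E} → O ⊨ C ⊑ D → O ⊨ D ⊑ E → O ⊨ C ⊑ E
⊨-trans C⊑D D⊑E I I⊨ d p = D⊑E I I⊨ d (C⊑D I I⊨ d p)

BethCounterexample⇒FailsBoth : ∀ {Ont f g} → BethCounterexample Ont f → FailsBoth Ont (ConceptIn g) (ConceptIn f)
BethCounterexample⇒FailsBoth {Ont} {f} {g} ce = ¬cip , ¬pbdp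
  where
  open BethCounterexample ce
  A⊑A′ : (O ++ primedCopy Sg O) ⊨ atom A ⊑ atom (prime Sg cSym A)
  A⊑A′ = implicitlyDefinable⇒⊑primed implicit

  ¬cip : ¬ HasCIP Ont (ConceptIn g) (ConceptIn f)
  ¬cip cip =
    let D , D∈f , D-shared , A⊑D , D⊑A′ = cip _ _ _ _ O∈logic copy∈logic tt tt A⊑A′
    in separation-noConceptBetween separation D D∈f
         (λ x∈ → shared⊆Sg (proj₁ (D-shared x∈)) (proj₂ (D-shared x∈))) A⊑D D⊑A′

  ¬pbdp : ¬ HasPBDP Ont (ConceptIn f)
  ¬pbdp pbdp with pbdp O A Sg O∈logic Sg⊆sigO implicit
  ... | C , C∈f , C⊆Sg , A⊑C , C⊑A =
    separation-noConceptBetween separation C C∈f C⊆Sg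
      (⊨-++ˡ {C = atom A} {D = C} A⊑C) (⊨-trans {C = C} {D = atom A} (⊨-++ˡ {C = C} C⊑A) A⊑A′)

pattern 1st = here refl
pattern 2nd = there 1st
pattern 3rd = there 2nd
pattern 4th = there 3rd
pattern 5th = there 4th
pattern 6th = there 5th

module ELu-counterexample where

  pattern A = 0
  pattern F = 1
  pattern E = 2
  pattern r = 0

  Sg : List Symbol
  Sg = cSym E ∷ []

  -- A is implicitly ∀u.E.
  O : Ontology
  O = CI top (ex (name r) (atom F)) ∷
      CI (ex (name r) (atom F ⊓ atom E)) (atom A) ∷
      CI (ex univ (atom A)) (atom E) ∷ []

  O∈ELu : CIOntology ELu O
  O∈ELu = All.lookup {P = IsCIof ELu} (_ ∷ _ ∷ _ ∷ [])

  A-transfers : TransfersAlong O A Sg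
  A-transfers I J I⊨O J⊨O (E-agree , _) d d∈A with J⊨O 1st d tt
  ... | f , df , f∈F =
    J⊨O 2nd d (f , df , f∈F , Equivalence.to (E-agree E 1st f) (I⊨O 3rd f (d , tt , d∈A)))

  data Point : Set where
    x y : Point

  Kᵇ : Structure Point
  Kᵇ = record
    { cn = λ { E d → d ≡ x ; F d → d ≡ y ; _ _ → ⊥ }
    ; rn = λ { r _ e → e ≡ y ; _ _ _ → ⊥ }
    ; ind = λ _ → x
    }

  K⊨O : IsModel (modulo10 Kᵇ) O
  K⊨O 1st _ _ = y , refl , refl
  K⊨O 2nd _ (_ , refl , _ , ())
  K⊨O 3rd _ (_ , _ , ())
  K⊨O (there (there (there ())))

  counterexample : BethCounterexample (CIOntology ELu) ELu
  counterexample = record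
    { Sg = Sg ; O = O ; A = A
    ; O∈logic = O∈ELu
    ; copy∈logic = CIOntology-rename (primeOutside Sg) O∈ELu
    ; Sg⊆sigO = toWitness {a? = Sg ⊆? sigO O} tt
    ; shared⊆Sg = toWitness {a? = sharedSymbols⊆? _ _ Sg} tt
    ; implicit = implicitlyDefinable A-transfers
    ; separation =
        separationAtSaturatedPoint (modulo10 Kᵇ) x (modulo10-isModel-withCopy Sg Kᵇ K⊨O) (λ ())
          (λ { 1st → refl ; (there ()) }) (λ { (there ()) }) (λ { (there ()) })
    }

module ELO-counterexample where

  pattern A = 0
  pattern F = 1
  pattern E = 2
  pattern M = 3
  pattern r = 0
  pattern s = 1
  pattern t = 2
  pattern a = 0

  Sg : List Symbol
  Sg = cSym E ∷ []

  -- A is implicitly ∀u.E: every element sees {a} via t, and A puts M on a.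
  O : Ontology
  O = CI top (ex (name r) (atom F)) ∷
      CI (ex (name r) (atom F ⊓ atom E)) (atom A) ∷
      CI (atom A) (ex (name s) (nominal a ⊓ atom M)) ∷
      CI (ex (name t) (atom M)) (atom E) ∷
      CI top (ex (name t) (nominal a)) ∷ []

  O∈ELO : CIOntology ELO O
  O∈ELO = All.lookup {P = IsCIof ELO} (_ ∷ _ ∷ _ ∷ _ ∷ _ ∷ [])

  A-transfers : TransfersAlong O A Sg
  A-transfers I J I⊨O J⊨O (E-agree , _) d d∈A with I⊨O 3rd d d∈A | J⊨O 1st d tt
  ... | m , _ , m≡a , m∈M | f , df , f∈F with I⊨O 5th f tt
  ... | b , fb , b≡a =
    J⊨O 2nd d (f , df , f∈F ,
      Equivalence.to (E-agree E 1st f) (I⊨O 4th f (b , fb , subst (cn I M) (trans m≡a (sym b≡a)) m∈M)))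

  data Point : Set where
    x y : Point

  Kᵇ : Structure Point
  Kᵇ = record
    { cn = λ { E d → d ≡ x ; F d → d ≡ y ; _ _ → ⊥ }
    ; rn = λ { r _ e → e ≡ y ; t _ e → e ≡ x ; _ _ _ → ⊥ }
    ; ind = λ _ → x
    }

  K⊨O : IsModel (modulo10 Kᵇ) O
  K⊨O 1st _ _ = y , refl , refl
  K⊨O 2nd _ (_ , refl , _ , ())
  K⊨O 3rd _ ()
  K⊨O 4th _ (_ , _ , ())
  K⊨O 5th _ _ = x , refl , refl
  K⊨O (there (there (there (there (there ())))))

  counterexample : BethCounterexample (CIOntology ELO) ELOu
  counterexample = record
    { Sg = Sg ; O = O ; A = A
    ; O∈logic = O∈ELO
    ; copy∈logic = CIOntology-rename (primeOutside Sg) O∈ELO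
    ; Sg⊆sigO = toWitness {a? = Sg ⊆? sigO O} tt
    ; shared⊆Sg = toWitness {a? = sharedSymbols⊆? _ _ Sg} tt
    ; implicit = implicitlyDefinable A-transfers
    ; separation =
        separationAtSaturatedPoint (modulo10 Kᵇ) x (modulo10-isModel-withCopy Sg Kᵇ K⊨O) (λ ())
          (λ { 1st → refl ; (there ()) }) (λ { (there ()) }) (λ { (there ()) })
    }

module ELSingleRI-counterexample where

  pattern A = 0
  pattern M = 3
  pattern X = 5
  pattern s = 2
  pattern r = 3

  Sg : List Symbol
  Sg = cSym X ∷ rSym s ∷ []

  O : Ontology
  O = CI (atom A) (ex (name r) (atom X)) ∷
      RI r (s ∷ []) s ∷
      CI (atom X) (ex (name s) (atom M)) ∷
      CI (ex (name s) (atom M)) (atom A) ∷ []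

  O∈logic : ELSingleRI O
  O∈logic = r , s , λ { 1st → inj₁ _ ; 2nd → inj₂ refl ; 3rd → inj₁ _ ; 4th → inj₁ _
                      ; (there (there (there (there ())))) }

  A-transfers : TransfersAlong O A Sg
  A-transfers I J I⊨O J⊨O (X-agree , s-agree , _) d d∈A with I⊨O 1st d d∈A
  ... | e , de , e∈X with J⊨O 3rd e (Equivalence.to (X-agree X 1st e) e∈X)
  ... | g , egᴶ , g∈M =
    J⊨O 4th d (g , Equivalence.to (s-agree s 2nd d g) dgᴵ , g∈M)
    where
    dgᴵ : rn I s d g
    dgᴵ = I⊨O 2nd d g (e , de , g , Equivalence.from (s-agree s 2nd e g) egᴶ , refl)

  data I-point : Set where
    d₀ e₀ g₀ : I-point

  data Aᴵ : I-point → Set where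
    d₀∈A : Aᴵ d₀
    e₀∈A : Aᴵ e₀

  data rᴵ : I-point → I-point → Set where
    d₀e₀ : rᴵ d₀ e₀
    e₀e₀ : rᴵ e₀ e₀

  data sᴵ : I-point → I-point → Set where
    d₀g₀ : sᴵ d₀ g₀
    e₀g₀ : sᴵ e₀ g₀

  Iᵇ : Structure I-point
  Iᵇ = record
    { cn = λ { A → Aᴵ ; X d → d ≡ e₀ ; M d → d ≡ g₀ ; _ _ → ⊥ }
    ; rn = λ { r → rᴵ ; s → sᴵ ; _ _ _ → ⊥ }
    ; ind = λ _ → d₀
    }

  I : Structure I-point
  I = modulo10 Iᵇ

  I⊨O : IsModel I O
  I⊨O 1st d₀ d₀∈A = e₀ , d₀e₀ , refl
  I⊨O 1st e₀ e₀∈A = e₀ , e₀e₀ , refl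
  I⊨O 2nd d₀ g₀ (e₀ , d₀e₀ , g₀ , e₀g₀ , refl) = d₀g₀
  I⊨O 2nd e₀ g₀ (e₀ , e₀e₀ , g₀ , e₀g₀ , refl) = e₀g₀
  I⊨O 3rd e₀ refl = g₀ , e₀g₀ , refl
  I⊨O 4th d₀ (g₀ , d₀g₀ , refl) = d₀∈A
  I⊨O 4th e₀ (g₀ , e₀g₀ , refl) = e₀∈A
  I⊨O (there (there (there (there ()))))

  data K-point : Set where
    x y z w : K-point

  data sᴷ : K-point → K-point → Set where
    xy : sᴷ x y
    zw : sᴷ z w

  Kᵇ : Structure K-point
  Kᵇ = record
    { cn = λ { A d → d ≡ z ; X d → d ≡ z ; M d → d ≡ w ; _ _ → ⊥ }
    ; rn = λ { r d e → d ≡ z × e ≡ z ; s → sᴷ ; _ _ _ → ⊥ }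
    ; ind = λ _ → x
    }

  K : Structure K-point
  K = modulo10 Kᵇ

  K⊨O : IsModel K O
  K⊨O 1st z refl = z , (refl , refl) , refl
  K⊨O 2nd z w (z , (refl , refl) , w , zw , refl) = zw
  K⊨O 3rd z refl = w , zw , refl
  K⊨O 4th z (w , zw , refl) = refl
  K⊨O (there (there (there (there ()))))

  data _∼_ : I-point → K-point → Set where
    d₀x : d₀ ∼ x
    e₀z : e₀ ∼ z
    g₀y : g₀ ∼ y
    g₀w : g₀ ∼ w

  simulation : Simulation ELu Sg I K
  simulation = record
    { _∼_ = _∼_
    ; atom-∼ = λ { 1st e₀z refl → refl ; (there (here ())) ; (there (there ())) }
    ; nominal-∼ = λ ()
    ; forth = λ { 2nd d₀x d₀g₀ → y , xy , g₀y ; 2nd e₀z e₀g₀ → w , zw , g₀w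
                ; (here ()) ; (there (there ())) }
    ; back = λ ()
    ; total = λ { _ d₀ → x , d₀x ; _ e₀ → z , e₀z ; _ g₀ → y , g₀y }
    }

  counterexample : BethCounterexample ELSingleRI ELu
  counterexample = record
    { Sg = Sg ; O = O ; A = A
    ; O∈logic = O∈logic
    ; copy∈logic = ELSingleRI-rename (primeOutside Sg) O∈logic
    ; Sg⊆sigO = toWitness {a? = Sg ⊆? sigO O} tt
    ; shared⊆Sg = toWitness {a? = sharedSymbols⊆? _ _ Sg} tt
    ; implicit = implicitlyDefinable A-transfers
    ; separation = record
      { I = I ; K = K
      ; I⊨O = modulo10-isModel-withCopy Sg Iᵇ I⊨O
      ; K⊨O = modulo10-isModel-withCopy Sg Kᵇ K⊨O
      ; simulation = simulation
      ; d = d₀ ; e = x ; d∼e = d₀x ; d∈A = d₀∈A ; e∉A′ = λ ()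
      }
    }

module ELHTrans-counterexample where

  pattern A = 0
  pattern M = 3
  pattern X = 5
  pattern s = 2
  pattern t = 4
  pattern q = 5

  Sg : List Symbol
  Sg = cSym X ∷ rSym s ∷ rSym q ∷ []

  O : Ontology
  O = CI (atom A) (ex (name t) (atom X)) ∷
      RI s [] t ∷
      RI t (t ∷ []) t ∷
      RI t [] q ∷
      CI (atom X) (ex (name s) (atom M)) ∷
      CI (ex (name q) (atom M)) (atom A) ∷ []

  O∈logic : ELHTrans O
  O∈logic = t , λ { 1st → inj₁ _ ; 2nd → inj₂ (inj₁ (s , t , refl)) ; 3rd → inj₂ (inj₂ refl)
                  ; 4th → inj₂ (inj₁ (t , q , refl)) ; 5th → inj₁ _ ; 6th → inj₁ _
                  ; (there (there (there (there (there (there ())))))) }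

  A-transfers : TransfersAlong O A Sg
  A-transfers I J I⊨O J⊨O (X-agree , r-agree , _) d d∈A with I⊨O 1st d d∈A
  ... | e , dtᴵe , e∈X with J⊨O 5th e (Equivalence.to (X-agree X 1st e) e∈X)
  ... | g , esᴶg , g∈M =
    J⊨O 6th d (g , Equivalence.to (r-agree q 3rd d g) dqᴵg , g∈M)
    where
    etᴵg : rn I t e g
    etᴵg = I⊨O 2nd e g (g , Equivalence.from (r-agree s 2nd e g) esᴶg , refl)
    dtᴵg : rn I t d g
    dtᴵg = I⊨O 3rd d g (e , dtᴵe , g , etᴵg , refl)
    dqᴵg : rn I q d g
    dqᴵg = I⊨O 4th d g (g , dtᴵg , refl)

  data I-point : Set where
    d₀ e₀ g₀ : I-point

  data Aᴵ : I-point → Set where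
    d₀∈A : Aᴵ d₀
    e₀∈A : Aᴵ e₀

  data tᴵ : I-point → I-point → Set where
    d₀e₀ : tᴵ d₀ e₀
    d₀g₀ : tᴵ d₀ g₀
    e₀e₀ : tᴵ e₀ e₀
    e₀g₀ : tᴵ e₀ g₀

  Iᵇ : Structure I-point
  Iᵇ = record
    { cn = λ { A → Aᴵ ; X d → d ≡ e₀ ; M d → d ≡ g₀ ; _ _ → ⊥ }
    ; rn = λ { t → tᴵ ; q → tᴵ ; s d e → d ≡ e₀ × e ≡ g₀ ; _ _ _ → ⊥ }
    ; ind = λ _ → d₀
    }

  I : Structure I-point
  I = modulo10 Iᵇ

  I⊨O : IsModel I O
  I⊨O 1st d₀ d₀∈A = e₀ , d₀e₀ , refl
  I⊨O 1st e₀ e₀∈A = e₀ , e₀e₀ , refl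
  I⊨O 2nd e₀ g₀ (g₀ , (refl , refl) , refl) = e₀g₀
  I⊨O 3rd d₀ e₀ (e₀ , d₀e₀ , e₀ , e₀e₀ , refl) = d₀e₀
  I⊨O 3rd d₀ g₀ (e₀ , d₀e₀ , g₀ , e₀g₀ , refl) = d₀g₀
  I⊨O 3rd e₀ e₀ (e₀ , e₀e₀ , e₀ , e₀e₀ , refl) = e₀e₀
  I⊨O 3rd e₀ g₀ (e₀ , e₀e₀ , g₀ , e₀g₀ , refl) = e₀g₀
  I⊨O 4th d e (e , dte , refl) = dte
  I⊨O 5th e₀ refl = g₀ , (refl , refl) , refl
  I⊨O 6th d₀ (g₀ , d₀g₀ , refl) = d₀∈A
  I⊨O 6th e₀ (g₀ , e₀g₀ , refl) = e₀∈A
  I⊨O (there (there (there (there (there (there ()))))))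

  data K-point : Set where
    x y z w : K-point

  data tᴷ : K-point → K-point → Set where
    zz : tᴷ z z
    zw : tᴷ z w

  data qᴷ : K-point → K-point → Set where
    xy : qᴷ x y
    xz : qᴷ x z
    zz : qᴷ z z
    zw : qᴷ z w

  Kᵇ : Structure K-point
  Kᵇ = record
    { cn = λ { A d → d ≡ z ; X d → d ≡ z ; M d → d ≡ w ; _ _ → ⊥ }
    ; rn = λ { t → tᴷ ; q → qᴷ ; s d e → d ≡ z × e ≡ w ; _ _ _ → ⊥ }
    ; ind = λ _ → x
    }

  K : Structure K-point
  K = modulo10 Kᵇ

  K⊨O : IsModel K O
  K⊨O 1st z refl = z , zz , refl
  K⊨O 2nd z w (w , (refl , refl) , refl) = zw
  K⊨O 3rd z z (z , zz , z , zz , refl) = zz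
  K⊨O 3rd z w (z , zz , w , zw , refl) = zw
  K⊨O 4th z z (z , zz , refl) = zz
  K⊨O 4th z w (w , zw , refl) = zw
  K⊨O 5th z refl = w , (refl , refl) , refl
  K⊨O 6th z (w , zw , refl) = refl
  K⊨O (there (there (there (there (there (there ()))))))

  data _∼_ : I-point → K-point → Set where
    d₀x : d₀ ∼ x
    e₀z : e₀ ∼ z
    g₀y : g₀ ∼ y
    g₀w : g₀ ∼ w

  simulation : Simulation ELu Sg I K
  simulation = record
    { _∼_ = _∼_
    ; atom-∼ = λ { 1st e₀z refl → refl ; (there (here ())) ; (there (there (here ()))) ; (there (there (there ()))) }
    ; nominal-∼ = λ ()
    ; forth = λ { 2nd e₀z (refl , refl) → w , (refl , refl) , g₀w
                ; 3rd d₀x d₀e₀ → z , xz , e₀z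
                ; 3rd d₀x d₀g₀ → y , xy , g₀y
                ; 3rd e₀z e₀e₀ → z , zz , e₀z
                ; 3rd e₀z e₀g₀ → w , zw , g₀w
                ; (here ()) ; (there (there (there ()))) }
    ; back = λ ()
    ; total = λ { _ d₀ → x , d₀x ; _ e₀ → z , e₀z ; _ g₀ → y , g₀y }
    }

  counterexample : BethCounterexample ELHTrans ELu
  counterexample = record
    { Sg = Sg ; O = O ; A = A
    ; O∈logic = O∈logic
    ; copy∈logic = ELHTrans-rename (primeOutside Sg) O∈logic
    ; Sg⊆sigO = toWitness {a? = Sg ⊆? sigO O} tt
    ; shared⊆Sg = toWitness {a? = sharedSymbols⊆? _ _ Sg} tt
    ; implicit = implicitlyDefinable A-transfers
    ; separation = record
      { I = I ; K = K
      ; I⊨O = modulo10-isModel-withCopy Sg Iᵇ I⊨O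
      ; K⊨O = modulo10-isModel-withCopy Sg Kᵇ K⊨O
      ; simulation = simulation
      ; d = d₀ ; e = x ; d∼e = d₀x ; d∈A = d₀∈A ; e∉A′ = λ ()
      }
    }

module ELI-counterexample where

  pattern A = 0
  pattern F = 1
  pattern E = 2
  pattern B = 4
  pattern r = 3

  Sg : List Symbol
  Sg = cSym B ∷ rSym r ∷ cSym E ∷ []

  -- A is implicitly B ⊓ ∀r.E.
  O : Ontology
  O = CI (atom B) (ex (name r) (atom F)) ∷
      CI (atom B ⊓ ex (name r) (atom F ⊓ atom E)) (atom A) ∷
      CI (atom A) (atom B) ∷
      CI (ex (inv r) (atom A)) (atom E) ∷ []

  O∈ELI : CIOntology ELI O
  O∈ELI = All.lookup {P = IsCIof ELI} (_ ∷ _ ∷ _ ∷ _ ∷ [])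

  A-transfers : TransfersAlong O A Sg
  A-transfers I J I⊨O J⊨O (c-agree , r-agree , _) d d∈A with Equivalence.to (c-agree B 1st d) (I⊨O 3rd d d∈A)
  ... | d∈Bᴶ with J⊨O 1st d d∈Bᴶ
  ... | f , drᴶf , f∈F =
    J⊨O 2nd d (d∈Bᴶ , f , drᴶf , f∈F , Equivalence.to (c-agree E 3rd f) f∈Eᴵ)
    where
    f∈Eᴵ : cn I E f
    f∈Eᴵ = I⊨O 4th f (d , Equivalence.from (r-agree r 2nd d f) drᴶf , d∈A)

  data I-point : Set where
    d₀ e₀ : I-point

  Iᵇ : Structure I-point
  Iᵇ = record
    { cn = λ { A d → d ≡ d₀ ; B d → d ≡ d₀ ; F d → d ≡ e₀ ; E d → d ≡ e₀ ; _ _ → ⊥ }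
    ; rn = λ { r d e → d ≡ d₀ × e ≡ e₀ ; _ _ _ → ⊥ }
    ; ind = λ _ → d₀
    }

  I : Structure I-point
  I = modulo10 Iᵇ

  I⊨O : IsModel I O
  I⊨O 1st _ refl = e₀ , (refl , refl) , refl
  I⊨O 2nd _ (refl , _) = refl
  I⊨O 3rd _ refl = refl
  I⊨O 4th _ (_ , (refl , refl) , refl) = refl
  I⊨O (there (there (there (there ()))))

  data K-point : Set where
    x y z : K-point

  data rᴷ : K-point → K-point → Set where
    xy : rᴷ x y
    xz : rᴷ x z

  Kᵇ : Structure K-point
  Kᵇ = record
    { cn = λ { B d → d ≡ x ; E d → d ≡ y ; F d → d ≡ z ; _ _ → ⊥ }
    ; rn = λ { r → rᴷ ; _ _ _ → ⊥ }
    ; ind = λ _ → x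
    }

  K : Structure K-point
  K = modulo10 Kᵇ

  K⊨O : IsModel K O
  K⊨O 1st x refl = z , xz , refl
  K⊨O 2nd x (refl , y , xy , () , _)
  K⊨O 2nd x (refl , z , xz , _ , ())
  K⊨O 3rd _ ()
  K⊨O 4th _ (_ , _ , ())
  K⊨O (there (there (there (there ()))))

  data _∼_ : I-point → K-point → Set where
    d₀x : d₀ ∼ x
    e₀y : e₀ ∼ y

  simulation : Simulation ELIu Sg I K
  simulation = record
    { _∼_ = _∼_
    ; atom-∼ = λ { 1st d₀x refl → refl ; 3rd e₀y refl → refl
                 ; (there (here ())) ; (there (there (there ()))) }
    ; nominal-∼ = λ ()
    ; forth = λ { 2nd d₀x (refl , refl) → y , xy , e₀y ; (here ()) ; (there (there (here ()))) ; (there (there (there ()))) }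
    ; back = λ { _ 2nd e₀y (refl , refl) → x , xy , d₀x ; _ (here ()) ; _ (there (there (here ()))) ; _ (there (there (there ()))) }
    ; total = λ { _ d₀ → x , d₀x ; _ e₀ → y , e₀y }
    }

  counterexample : BethCounterexample (CIOntology ELI) ELIu
  counterexample = record
    { Sg = Sg ; O = O ; A = A
    ; O∈logic = O∈ELI
    ; copy∈logic = CIOntology-rename (primeOutside Sg) O∈ELI
    ; Sg⊆sigO = toWitness {a? = Sg ⊆? sigO O} tt
    ; shared⊆Sg = toWitness {a? = sharedSymbols⊆? _ _ Sg} tt
    ; implicit = implicitlyDefinable A-transfers
    ; separation = record
      { I = I ; K = K
      ; I⊨O = modulo10-isModel-withCopy Sg Iᵇ I⊨O
      ; K⊨O = modulo10-isModel-withCopy Sg Kᵇ K⊨O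
      ; simulation = simulation
      ; d = d₀ ; e = x ; d∼e = d₀x ; d∈A = refl ; e∉A′ = λ ()
      }
    }

theorem1 :
    -- (1) ELu
    FailsBoth (CIOntology ELu) (ConceptIn ELu) (ConceptIn ELu) ×
    -- (2) ELO, and ELO with u in interpolants / definitions
    FailsBoth (CIOntology ELO) (ConceptIn ELO) (ConceptIn ELO) ×
    FailsBoth (CIOntology ELO) (ConceptIn ELO) (ConceptIn ELOu) ×
    -- (3) EL with a single role inclusion r ∘ s ⊑ s
    FailsBoth ELSingleRI (ConceptIn EL) (ConceptIn EL) ×
    FailsBoth ELSingleRI (ConceptIn EL) (ConceptIn ELu) ×
    -- (4) EL with role hierarchies and a transitive role
    FailsBoth ELHTrans (ConceptIn EL) (ConceptIn EL) ×
    FailsBoth ELHTrans (ConceptIn EL) (ConceptIn ELu) ×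
    -- (5) ELI
    FailsBoth (CIOntology ELI) (ConceptIn ELI) (ConceptIn ELI) ×
    FailsBoth (CIOntology ELI) (ConceptIn ELI) (ConceptIn ELIu)
theorem1 =
  BethCounterexample⇒FailsBoth ELu-counterexample.counterexample ,
  FailsBoth-withoutUniv ELO-fails , ELO-fails ,
  FailsBoth-withoutUniv ELSingleRI-fails , ELSingleRI-fails ,
  FailsBoth-withoutUniv ELHTrans-fails , ELHTrans-fails ,
  FailsBoth-withoutUniv ELI-fails , ELI-fails
  where
  ELO-fails : FailsBoth (CIOntology ELO) (ConceptIn ELO) (ConceptIn ELOu)
  ELO-fails = BethCounterexample⇒FailsBoth ELO-counterexample.counterexample
  ELSingleRI-fails : FailsBoth ELSingleRI (ConceptIn EL) (ConceptIn ELu)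
  ELSingleRI-fails = BethCounterexample⇒FailsBoth ELSingleRI-counterexample.counterexample
  ELHTrans-fails : FailsBoth ELHTrans (ConceptIn EL) (ConceptIn ELu)
  ELHTrans-fails = BethCounterexample⇒FailsBoth ELHTrans-counterexample.counterexample
  ELI-fails : FailsBoth (CIOntology ELI) (ConceptIn ELI) (ConceptIn ELIu)
  ELI-fails = BethCounterexample⇒FailsBoth ELI-counterexample.counterexample
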